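{- For every weakly acyclic NFA $\mathcal{A}$ over $\Sigma$, there is a weakly acyclic expression describing $L(\mathcal{A})$.
   Context: An NFA $(Q,\Sigma,\delta,q_0,F)$ is weakly acyclic if for every $q\in Q$ and nonempty word $w$, $q\in\delta(q,w)$ implies $\delta(q,c)=\{q\}$ for every letter $c$ occurring in $w$. Weakly acyclic expressions over $\Sigma$ are generated by the grammar $r ::= \emptyset \mid \Gamma^* \mid \Lambda^* a\, r \mid r + r$, where $\Gamma,\Lambda\subseteq\Sigma$ and $a\in\Sigma\setminus\Lambda$, with the usual regular-expression semantics. -}

module Defs where

open import Data.Nat using (ℕ)
open import Data.Fin using (Fin)
open import Data.Fin.Subset using (Subset; _∈_; _∉_)
open import Data.List using (List; []; _∷_; _++_)
open import Data.List.Relation.Unary.All using (All)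
open import Data.List.Membership.Propositional using () renaming (_∈_ to _∈ₗ_)
open import Data.Product using (_×_; Σ; ∃; _,_)
open import Relation.Binary.PropositionalEquality using (_≡_; _≢_)
open import Function.Bundles using (_⇔_)

Word : ℕ → Set
Word k = List (Fin k)

record NFA (k : ℕ) : Set where
  field
    n  : ℕ
    δ  : Fin n → Fin k → Subset n
    q₀ : Fin n
    F  : Subset n

module _ {k : ℕ} (A : NFA k) where
  open NFA A

  data Reach : Fin n → Word k → Fin n → Set where
    ε-step : ∀ {q} → Reach q [] q
    c-step : ∀ {q q' q'' c w} → q' ∈ δ q c → Reach q' w q'' → Reach q (c ∷ w) q''

  Accepts : Word k → Set
  Accepts w = ∃ λ q → Reach q₀ w q × q ∈ F

  WeaklyAcyclic : Set
  WeaklyAcyclic = ∀ (q : Fin n) (w : Word k) → w ≢ [] → Reach q w q →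
    ∀ (c : Fin k) → c ∈ₗ w → ∀ (q' : Fin n) → (q' ∈ δ q c ⇔ q' ≡ q)

-- Weakly acyclic expressions: r ::= ∅ | Γ* | Λ* a r | r + r   (a ∉ Λ)
data WAExpr (k : ℕ) : Set where
  ∅     : WAExpr k
  star  : Subset k → WAExpr k
  pre   : (Λ : Subset k) (a : Fin k) → a ∉ Λ → WAExpr k → WAExpr k
  _⊕_   : WAExpr k → WAExpr k → WAExpr k

data _∈⟦_⟧ {k : ℕ} : Word k → WAExpr k → Set where
  in-star : ∀ {Γ w} → All (_∈ Γ) w → w ∈⟦ star Γ ⟧
  in-pre  : ∀ {Λ a p r u v} → All (_∈ Λ) u → v ∈⟦ r ⟧ → (u ++ a ∷ v) ∈⟦ pre Λ a p r ⟧
  in-l    : ∀ {r s w} → w ∈⟦ r ⟧ → w ∈⟦ r ⊕ s ⟧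
  in-r    : ∀ {r s w} → w ∈⟦ s ⟧ → w ∈⟦ r ⊕ s ⟧

{-# OPTIONS --safe #-}
-- In a weakly acyclic NFA a letter c that loops on a state q loops only there, so a run
-- from q reads a word of Γ_q* (Γ_q the letters looping on q) and then either stops at q or
-- leaves q for good via some a ∉ Γ_q.  Hence
--   L(q) = [q ∈ F] Γ_q* + Σ { Γ_q* a L(q') | a ∉ Γ_q, q' ∈ δ(q, a) },
-- and the recursion is well founded: every q' is reachable from q and distinct from it,
-- and weak acyclicity makes this relation a strict partial order on the finite set of states.
module Submission where

open import Defs
open import Data.Nat using (ℕ; zero; suc)
open import Data.Fin using (Fin; zero; suc)
open import Data.Fin.Subset using (Subset; _∈_; _∉_)
open import Data.Fin.Subset.Properties using (_∈?_)
open import Data.Fin.Induction using (spo-wellFounded)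
open import Data.Vec using (tabulate; lookup)
open import Data.Vec.Properties using (lookup∘tabulate; []=⇒lookup; lookup⇒[]=)
open import Data.List using ([]; _∷_; _++_)
open import Data.List.Relation.Unary.All using (All; []; _∷_)
open import Data.List.Relation.Unary.Any using (here; there)
open import Data.List.Membership.Propositional using () renaming (_∈_ to _∈ₗ_)
open import Data.List.Membership.Propositional.Properties using (∈-++⁺ˡ)
open import Data.Product using (∃; _×_; _,_; proj₁; proj₂)
open import Data.Empty using (⊥-elim)
open import Relation.Nullary using (Dec; yes; no)
open import Relation.Nullary.Decidable.Core using (¬?; _×-dec_)
open import Relation.Binary.PropositionalEquality
  using (_≡_; _≢_; refl; sym; trans; isEquivalence; resp₂)
open import Relation.Binary.Structures using (IsStrictPartialOrder)
open import Induction.WellFounded using (WellFounded; WfRec; module All)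
open import Function.Bundles using (_⇔_; mk⇔; Equivalence)

open Equivalence using (to; from)

module _ {k : ℕ} where

  ⨁ : ∀ {m} → (Fin m → WAExpr k) → WAExpr k
  ⨁ {zero}  f = ∅
  ⨁ {suc m} f = f zero ⊕ ⨁ (λ i → f (suc i))

  ∈-⨁⁺ : ∀ {m} (f : Fin m → WAExpr k) {w} → ∃ (λ i → w ∈⟦ f i ⟧) → w ∈⟦ ⨁ f ⟧
  ∈-⨁⁺ f (zero  , w∈) = in-l w∈
  ∈-⨁⁺ f (suc i , w∈) = in-r (∈-⨁⁺ (λ i → f (suc i)) (i , w∈))

  ∈-⨁⁻ : ∀ {m} (f : Fin m → WAExpr k) {w} → w ∈⟦ ⨁ f ⟧ → ∃ (λ i → w ∈⟦ f i ⟧)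
  ∈-⨁⁻ {suc m} f (in-l w∈) = zero , w∈
  ∈-⨁⁻ {suc m} f (in-r w∈) with ∈-⨁⁻ (λ i → f (suc i)) w∈
  ... | i , w∈′ = suc i , w∈′

  when : ∀ {P : Set} → Dec P → (P → WAExpr k) → WAExpr k
  when (yes p) f = f p
  when (no _)  f = ∅

  -- The premise quantifies over all proofs of P, since the one stored in the decision may differ.
  ∈-when⁺ : ∀ {P : Set} (d : Dec P) (f : P → WAExpr k) {w} →
            (∀ p → w ∈⟦ f p ⟧) → P → w ∈⟦ when d f ⟧
  ∈-when⁺ (yes p) f w∈ _ = w∈ p
  ∈-when⁺ (no ¬p) f w∈ p = ⊥-elim (¬p p)

  ∈-when⁻ : ∀ {P : Set} (d : Dec P) (f : P → WAExpr k) {w} →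
            w ∈⟦ when d f ⟧ → ∃ λ p → w ∈⟦ f p ⟧
  ∈-when⁻ (yes p) f w∈ = p , w∈

module Runs {k : ℕ} (A : NFA k) where
  open NFA A

  Reach-++ : ∀ {p q r u v} → Reach A p u q → Reach A q v r → Reach A p (u ++ v) r
  Reach-++ ε-step       r′ = r′
  Reach-++ (c-step t r) r′ = c-step t (Reach-++ r r′)

  Reach-stuck : ∀ {q q′ u} → (∀ c → c ∈ₗ u → ∀ p → p ∈ δ q c → p ≡ q) →
                Reach A q u q′ → q′ ≡ q
  Reach-stuck stuck ε-step = refl
  Reach-stuck stuck (c-step t r) with stuck _ (here refl) _ t
  ... | refl = Reach-stuck (λ c c∈ → stuck c (there c∈)) r

  selfLoops : Fin n → Subset k
  selfLoops q = tabulate (λ c → lookup (δ q c) q)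

  ∈-selfLoops⁻ : ∀ {q c} → c ∈ selfLoops q → q ∈ δ q c
  ∈-selfLoops⁻ {q} {c} c∈ = lookup⇒[]= q (δ q c)
    (trans (sym (lookup∘tabulate (λ c → lookup (δ q c) q) c)) ([]=⇒lookup c∈))

  ∈-selfLoops⁺ : ∀ {q c} → q ∈ δ q c → c ∈ selfLoops q
  ∈-selfLoops⁺ {q} {c} q∈ = lookup⇒[]= c (selfLoops q)
    (trans (lookup∘tabulate (λ c → lookup (δ q c) q) c) ([]=⇒lookup q∈))

  Reach-selfLoops : ∀ {q u} → All (_∈ selfLoops q) u → Reach A q u q
  Reach-selfLoops []         = ε-step
  Reach-selfLoops (c∈ ∷ cs∈) = c-step (∈-selfLoops⁻ c∈) (Reach-selfLoops cs∈)

  Lang : Fin n → Word k → Set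
  Lang q w = ∃ λ f → Reach A q w f × f ∈ F

  Expressible : Fin n → Set
  Expressible q = ∃ λ (r : WAExpr k) → ∀ w → Lang q w ⇔ w ∈⟦ r ⟧

module WeaklyAcyclicNFA {k : ℕ} (A : NFA k) (wa : WeaklyAcyclic A) where
  open NFA A
  open Runs A

  selfLoop-unique : ∀ {q c p} → c ∈ selfLoops q → p ∈ δ q c → p ≡ q
  selfLoop-unique {q} {c} c∈ t =
    to (wa q (c ∷ []) (λ ()) (c-step (∈-selfLoops⁻ c∈) ε-step) c (here refl) _) t

  cycle-trivial : ∀ {p q u v} → Reach A p v q → Reach A q u p → q ≡ p
  cycle-trivial ε-step _ = refl
  cycle-trivial {p} {u = u} {v} r@(c-step _ _) r′ = Reach-stuck stuck r
    where
    stuck : ∀ c → c ∈ₗ v → ∀ p′ → p′ ∈ δ p c → p′ ≡ p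
    stuck c c∈ p′ = to (wa p (v ++ u) (λ ()) (Reach-++ r r′) c (∈-++⁺ˡ c∈) p′)

  _⊏_ : Fin n → Fin n → Set
  q ⊏ p = q ≢ p × ∃ λ w → Reach A p w q

  ⊏-trans : ∀ {p q r} → p ⊏ q → q ⊏ r → p ⊏ r
  ⊏-trans {p} {q} {r} (p≢q , u , q→p) (q≢r , v , r→q) = p≢r , v ++ u , Reach-++ r→q q→p
    where
    p≢r : p ≢ r
    p≢r refl = q≢r (cycle-trivial r→q q→p)

  ⊏-isStrictPartialOrder : IsStrictPartialOrder _≡_ _⊏_
  ⊏-isStrictPartialOrder = record
    { isEquivalence = isEquivalence
    ; irrefl        = λ { refl (q≢q , _) → q≢q refl }
    ; trans         = ⊏-trans
    ; <-resp-≈      = resp₂ _⊏_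
    }

  ⊏-wellFounded : WellFounded _⊏_
  ⊏-wellFounded = spo-wellFounded ⊏-isStrictPartialOrder

  exit-⊏ : ∀ {q a q′} → a ∉ selfLoops q → q′ ∈ δ q a → q′ ⊏ q
  exit-⊏ a∉ t = (λ { refl → a∉ (∈-selfLoops⁺ t) }) , _ , c-step t ε-step

  data Decomposition (q f : Fin n) : Word k → Set where
    stays : ∀ {w} → All (_∈ selfLoops q) w → f ≡ q → Decomposition q f w
    exits : ∀ {u a v q′} → All (_∈ selfLoops q) u → a ∉ selfLoops q → q′ ∈ δ q a →
            Reach A q′ v f → Decomposition q f (u ++ a ∷ v)

  decompose : ∀ {q w f} → Reach A q w f → Decomposition q f w
  decompose ε-step = stays [] refl
  decompose {q} (c-step {c = c} t r) with c ∈? selfLoops q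
  ... | no  c∉ = exits [] c∉ t r
  ... | yes c∈ with selfLoop-unique c∈ t
  ... | refl with decompose r
  ... | stays cs∈ f≡q     = stays (c∈ ∷ cs∈) f≡q
  ... | exits cs∈ a∉ t′ r′ = exits (c∈ ∷ cs∈) a∉ t′ r′

  module Unfold (q : Fin n) (ih : WfRec _⊏_ Expressible q) where

    Exit : Fin k → Fin n → Set
    Exit a q′ = a ∉ selfLoops q × q′ ∈ δ q a

    exit? : ∀ a q′ → Dec (Exit a q′)
    exit? a q′ = ¬? (a ∈? selfLoops q) ×-dec (q′ ∈? δ q a)

    exitExpr : ∀ a q′ → Exit a q′ → WAExpr k
    exitExpr a q′ (a∉ , t) = pre (selfLoops q) a a∉ (proj₁ (ih (exit-⊏ a∉ t)))

    stayExpr : WAExpr k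
    stayExpr = when (q ∈? F) (λ _ → star (selfLoops q))

    expr : WAExpr k
    expr = stayExpr ⊕ ⨁ λ a → ⨁ λ q′ → when (exit? a q′) (exitExpr a q′)

    sound : ∀ {w} → w ∈⟦ expr ⟧ → Lang q w
    sound (in-l w∈) with ∈-when⁻ (q ∈? F) _ w∈
    ... | q∈F , in-star cs∈ = q , Reach-selfLoops cs∈ , q∈F
    sound (in-r w∈) with ∈-⨁⁻ _ w∈
    ... | a , w∈′ with ∈-⨁⁻ _ w∈′
    ... | q′ , w∈″ with ∈-when⁻ (exit? a q′) (exitExpr a q′) w∈″
    ... | (a∉ , t) , in-pre cs∈ v∈ with from (proj₂ (ih (exit-⊏ a∉ t)) _) v∈
    ... | f , r , f∈F = f , Reach-++ (Reach-selfLoops cs∈) (c-step t r) , f∈F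

    complete : ∀ {w} → Lang q w → w ∈⟦ expr ⟧
    complete (f , r , f∈F) with decompose r
    ... | stays cs∈ refl = in-l (∈-when⁺ (q ∈? F) _ (λ _ → in-star cs∈) f∈F)
    ... | exits {u} {a} {v} {q′} cs∈ a∉ t r′ =
      in-r (∈-⨁⁺ _ (a , ∈-⨁⁺ _ (q′ , ∈-when⁺ (exit? a q′) (exitExpr a q′) via (a∉ , t))))
      where
      via : ∀ e → (u ++ a ∷ v) ∈⟦ exitExpr a q′ e ⟧
      via (a∉′ , t′) = in-pre cs∈ (to (proj₂ (ih (exit-⊏ a∉′ t′)) v) (f , r′ , f∈F))

  expressible : ∀ q → Expressible q
  expressible = All.wfRec ⊏-wellFounded _ Expressible
    λ q ih → Unfold.expr q ih , λ w → mk⇔ (Unfold.complete q ih) (Unfold.sound q ih)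

proposition14 : ∀ {k : ℕ} (A : NFA k) → WeaklyAcyclic A →
    ∃ λ (r : WAExpr k) → ∀ (w : Word k) → (Accepts A w ⇔ w ∈⟦ r ⟧)
proposition14 A wa = WeaklyAcyclicNFA.expressible A wa (NFA.q₀ A)
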